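{- If $n$ is an even perfect square, then \[ h(n) > 2^n \left( 1 - \frac{4\sqrt{n}}{2^{\sqrt{n}/2}} \right), \] where $h(n)$ is the maximum, over all permutations $\sigma$ of $[n]$, of the number of distinct patterns occurring in $\sigma$.
   Context: Given a sequence $t_1,\dots,t_k$ of distinct elements of a totally ordered set, its pattern is the unique permutation $\tau$ of $[k]$ with $t_i<t_j \iff \tau(i)<\tau(j)$ for all $i,j$. For a permutation $\sigma$ of $[n]$ (in one-line notation) and a nonempty $X\subseteq[n]$, $\sigma_X$ denotes the pattern of the subsequence of $\sigma$ with indices in $X$. Let $P(\sigma)=\{\sigma_X : \emptyset\neq X\subseteq[n]\}$ and $h(n)=\max\{|P(\sigma)| : \sigma \text{ a permutation of } [n]\}$. -}

module Defs where

open import Data.Bool using (Bool; true; false; if_then_else_)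
open import Data.Nat using (ℕ; zero; suc; _⊔_; _<?_)
import Data.Nat as ℕ
open import Data.Fin using (Fin; toℕ)
open import Data.Fin.Subset using (Subset)
open import Data.List using (List; []; _∷_; map; filter; length; concatMap; foldr; deduplicate; allFin)
open import Data.Bool.ListAction using (any)
import Data.List.Properties as LP
open import Data.Vec using (Vec; []; _∷_; toList)
open import Data.List.Relation.Unary.Unique.Propositional using (Unique)
import Data.List.Relation.Unary.AllPairs as AllPairs
open import Data.Fin.Properties using (_≟_)
open import Relation.Nullary using (¬?)

allVecs : (n k : ℕ) → List (Vec (Fin n) k)
allVecs n zero    = [] ∷ []
allVecs n (suc k) = concatMap (λ i → map (i ∷_) (allVecs n k)) (allFin n)

-- A permutation of [n] in one-line notation: a vector (σ(1),…,σ(n)) with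
-- distinct entries in Fin n (0-indexed).
Perm : ℕ → Set
Perm n = Vec (Fin n) n

allPerms : (n : ℕ) → List (Perm n)
allPerms n = filter (λ v → AllPairs.allPairs? (λ x y → ¬? (x ≟ y)) (toList v)) (allVecs n n)

allSubsets : (n : ℕ) → List (Subset n)
allSubsets zero    = [] ∷ []
allSubsets (suc n) = concatMap (λ X → (true ∷ X) ∷ (false ∷ X) ∷ []) (allSubsets n)

nonempty : ∀ {n} → Subset n → Bool
nonempty X = any (λ b → b) (toList X)

select : ∀ {n k} → Subset k → Vec (Fin n) k → List ℕ
select []           []       = []
select (true  ∷ X) (x ∷ xs) = toℕ x ∷ select X xs
select (false ∷ X) (x ∷ xs) = select X xs

-- Pattern of a list of distinct naturals: each entry replaced by its rank
-- (number of entries smaller than it), giving a permutation of {0,…,k-1}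
-- in one-line notation (the 0-indexed version of the pattern in [k]).
pattern′ : List ℕ → List ℕ
pattern′ xs = map (λ x → length (filter (_<? x) xs)) xs

numPatterns : ∀ {n} → Perm n → ℕ
numPatterns {n} σ =
  length (deduplicate (LP.≡-dec ℕ._≟_)
    (map (λ X → pattern′ (select X σ)) (filter (λ X → nonempty X Data.Bool.≟ true) (allSubsets n))))

h : ℕ → ℕ
h n = foldr _⊔_ 0 (map numPatterns (allPerms n))

-- Let m = 2k and let σ act on the m × m grid, with cells numbered row by row, by transposition:
-- cell (i, j) is sent to (j, i).  Call X ⊆ [m²] good if every row and every column of the grid
-- has a cell of X in each of its halves (other coordinate < k, and ≥ k).
--
-- The pattern σ_X compares elements of X row by row (positions) and column by column (values).
-- Along a chain of elements of X with increasing positions, a step to a smaller value must go to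
-- a later row, so the number of such descents in a chain ending at x bounds the row of x; when X
-- is good the bound is attained, by descending from the upper half of each row into the lower
-- half of the next one.  So σ_X determines the rows of the elements of X, symmetrically their
-- columns, hence X itself: good subsets have pairwise distinct patterns.
--
-- X is bad only if it misses one of the 4m half-lines, each of which has k cells, so at most
-- 4m · 2^(m² − k) subsets are bad.  A singleton contributes one more pattern, making the bound strict.

module Submission where

open import Data.Nat
open import Data.Nat.Properties
open import Data.Nat.DivMod
open import Data.Nat.Divisibility using (divides-refl)
open import Data.Bool using (Bool; true; false; not; _∧_; T; T?)
import Data.Bool
open import Data.Bool.Properties using (T-not-≡; T-∧)
open import Data.Bool.ListAction using (all)
open import Data.Fin using (Fin; toℕ; fromℕ<) renaming (zero to fzero; suc to fsuc)
open import Data.Fin.Properties using (toℕ<n; toℕ-fromℕ<; toℕ-injective)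
open import Data.Fin.Subset using (Subset; ∣_∣; ⁅_⁆)
open import Data.Fin.Subset.Properties using (∣⁅x⁆∣≡1)
open import Data.Vec using (Vec; []; _∷_; lookup; tabulate; toList)
open import Data.Vec.Properties using (lookup∘tabulate)
import Data.Vec.Relation.Unary.All.Properties as VecAll
import Data.Vec.Relation.Unary.AllPairs as VecAllPairs
open import Data.Vec.Relation.Unary.Unique.Propositional using () renaming (Unique to VecUnique)
import Data.Vec.Relation.Unary.Unique.Propositional.Properties as VecUnique
open import Data.List using (List; []; _∷_; length; map; filter; filterᵇ; concatMap; foldr; upTo)
open import Data.List.Properties
  using ( length-map; length-++; length-upTo; length-removeAt′
        ; filter-accept; filter-reject; filter-all; ∷-injectiveʳ; ≡-dec )
open import Data.List.Membership.Propositional using (_∈_; _∉_; _─_; find; lose)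
open import Data.List.Membership.Propositional.Properties
  using ( ∈-map⁺; ∈-map⁻; ∈-filter⁺; ∈-filter⁻; ∈-deduplicate⁺
        ; ∈-concatMap⁺; ∈-concatMap⁻; ∈-allFin; ∈-upTo⁺; ∈-upTo⁻ )
open import Data.List.Relation.Unary.Any using (here; there)
import Data.List.Relation.Unary.All as All
import Data.List.Relation.Unary.All.Properties as All
open import Data.List.Relation.Unary.AllPairs using ([]; _∷_)
open import Data.List.Relation.Unary.Unique.Propositional using (Unique)
import Data.List.Relation.Unary.Unique.Propositional.Properties as Unique
open import Data.List.Relation.Binary.Subset.Propositional using (_⊆_)
import Data.List.Relation.Binary.Sublist.Propositional as Sublist
import Data.List.Relation.Binary.Sublist.Propositional.Properties as Sublist
open import Data.Product using (_×_; _,_; proj₁; proj₂; ∃-syntax)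
open import Data.Sum using (inj₁; inj₂)
open import Function using (_∘_; Equivalence)
open import Relation.Binary.PropositionalEquality
open import Relation.Binary.Definitions using (tri<; tri≈; tri>)
open import Relation.Nullary using (Dec; does; yes; no; contradiction)
open import Relation.Nullary.Decidable using (dec-true; _×-dec_)
import Algebra.Properties.CommutativeSemigroup *-commutativeSemigroup as *-CS
open import Defs

module _ {A : Set} where

  ∈-─⁺ : ∀ {x y} {ys : List A} (y∈ys : y ∈ ys) → x ∈ ys → x ≢ y → x ∈ ys ─ y∈ys
  ∈-─⁺ (here refl)  (here refl)  x≢y = contradiction refl x≢y
  ∈-─⁺ (here refl)  (there x∈ys) _   = x∈ys
  ∈-─⁺ (there _)    (here refl)  _   = here refl
  ∈-─⁺ (there y∈ys) (there x∈ys) x≢y = there (∈-─⁺ y∈ys x∈ys x≢y)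

  unique-⊆⇒length-≤ : ∀ {xs ys : List A} → Unique xs → xs ⊆ ys → length xs ≤ length ys
  unique-⊆⇒length-≤ {[]}          _          _     = z≤n
  unique-⊆⇒length-≤ {x ∷ xs} {ys} (x≢xs ∷ u) xs⊆ys = begin
    suc (length xs)          ≤⟨ s≤s (unique-⊆⇒length-≤ u xs⊆ys─x) ⟩
    suc (length (ys ─ x∈ys)) ≡⟨ length-removeAt′ ys _ ⟨
    length ys                ∎
    where
    open ≤-Reasoning
    x∈ys = xs⊆ys (here refl)
    xs⊆ys─x : xs ⊆ ys ─ x∈ys
    xs⊆ys─x z∈xs = ∈-─⁺ x∈ys (xs⊆ys (there z∈xs)) λ { refl → All.lookup x≢xs z∈xs refl }

  unique-map⁺ : ∀ {B : Set} {f : A → B} {xs : List A} →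
    (∀ {x y} → x ∈ xs → y ∈ xs → f x ≡ f y → x ≡ y) → Unique xs → Unique (map f xs)
  unique-map⁺ {xs = []}     _   []         = []
  unique-map⁺ {xs = x ∷ xs} inj (x≢xs ∷ u) =
    All.map⁺ (All.tabulate λ y∈xs fx≡fy →
      All.lookup x≢xs y∈xs (inj (here refl) (there y∈xs) fx≡fy))
    ∷ unique-map⁺ (λ x∈ y∈ → inj (there x∈) (there y∈)) u

toList-unique : ∀ {A : Set} {l} {v : Vec A l} → VecUnique v → Unique (toList v)
toList-unique VecAllPairs.[]         = []
toList-unique (v≢ VecAllPairs.∷ u) = VecAll.toList⁺ v≢ ∷ toList-unique u

≤-foldr-⊔ : ∀ {A : Set} (f : A → ℕ) xs {x} → x ∈ xs → f x ≤ foldr _⊔_ 0 (map f xs)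
≤-foldr-⊔ f (y ∷ xs) (here refl) = m≤m⊔n (f y) _
≤-foldr-⊔ f (y ∷ xs) (there x∈)  = ≤-trans (≤-foldr-⊔ f xs x∈) (m≤n⊔m (f y) _)

length-concatMap-const : ∀ {A B : Set} {f : A → List B} {c} → (∀ x → length (f x) ≡ c) →
  ∀ xs → length (concatMap f xs) ≡ length xs * c
length-concatMap-const         ∣f∣≡c []       = refl
length-concatMap-const {f = f} ∣f∣≡c (x ∷ xs) =
  trans (length-++ (f x)) (cong₂ _+_ (∣f∣≡c x) (length-concatMap-const ∣f∣≡c xs))

distinct-indices⇒2≤ : ∀ {a b L} → a < L → b < L → a ≢ b → 2 ≤ L
distinct-indices⇒2≤ {zero}  {zero}  _        _        a≢b = contradiction refl a≢b
distinct-indices⇒2≤ {suc a} {_}     (s≤s a<) _        _   = s≤s (≤-trans (s≤s z≤n) a<)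
distinct-indices⇒2≤ {zero}  {suc b} _        (s≤s b<) _   = s≤s (≤-trans (s≤s z≤n) b<)

does≡true⇒ : ∀ {A : Set} (a? : Dec A) → does a? ≡ true → A
does≡true⇒ (yes a) _ = a

T-all⇒∈ : ∀ {A : Set} (p : A → Bool) xs {x} → T (all p xs) → x ∈ xs → T (p x)
T-all⇒∈ p (y ∷ xs) t (here refl) = proj₁ (Equivalence.to T-∧ t)
T-all⇒∈ p (y ∷ xs) t (there x∈)  = T-all⇒∈ p xs (proj₂ (Equivalence.to T-∧ t)) x∈

count : ∀ {A : Set} → (A → Bool) → List A → ℕ
count p xs = length (filterᵇ p xs)

count-≤-∧-not : ∀ {A : Set} (p q : A → Bool) xs →
  count p xs ≤ count (λ x → not (q x) ∧ p x) xs + count q xs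
count-≤-∧-not p q []       = z≤n
count-≤-∧-not p q (x ∷ xs) with p x | q x | count-≤-∧-not p q xs
... | true  | true  | ih = ≤-trans (s≤s ih) (≤-reflexive (sym (+-suc _ _)))
... | true  | false | ih = s≤s ih
... | false | true  | ih = ≤-trans ih (+-monoʳ-≤ (count (λ x → not (q x) ∧ p x) xs) (n≤1+n _))
... | false | false | ih = ih

-- Out-of-range indices read 0.
nth : List ℕ → ℕ → ℕ
nth []       _       = 0
nth (x ∷ xs) zero    = x
nth (x ∷ xs) (suc a) = nth xs a

nth-map : ∀ (f : ℕ → ℕ) xs {a} → a < length xs → nth (map f xs) a ≡ f (nth xs a)
nth-map f (x ∷ xs) {zero}  _        = refl
nth-map f (x ∷ xs) {suc a} (s≤s a<) = nth-map f xs a<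

nth-∈ : ∀ xs {a} → a < length xs → nth xs a ∈ xs
nth-∈ (x ∷ xs) {zero}  _        = here refl
nth-∈ (x ∷ xs) {suc a} (s≤s a<) = there (nth-∈ xs a<)

∈⇒nth : ∀ {x} xs → x ∈ xs → ∃[ a ] a < length xs × nth xs a ≡ x
∈⇒nth (y ∷ xs) (here refl) = 0 , z<s , refl
∈⇒nth (y ∷ xs) (there x∈) with ∈⇒nth xs x∈
... | a , a< , eq = suc a , s≤s a< , eq

nth-ext : ∀ xs ys → length xs ≡ length ys →
  (∀ a → a < length xs → nth xs a ≡ nth ys a) → xs ≡ ys
nth-ext []       []       _   _  = refl
nth-ext (x ∷ xs) (y ∷ ys) len eq =
  cong₂ _∷_ (eq 0 z<s) (nth-ext xs ys (suc-injective len) λ a a< → eq (suc a) (s≤s a<))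

-- Patterns

rank : List ℕ → ℕ → ℕ
rank s x = length (filter (_<? x) s)

rank-mono : ∀ s {x y} → x ≤ y → rank s x ≤ rank s y
rank-mono s x≤y = Sublist.length-mono-≤
  (Sublist.filter⁺ (_<? _) (_<? _) (λ { refl z<x → <-≤-trans z<x x≤y }) (Sublist.⊆-refl {x = s}))

rank-∷-< : ∀ s {z x} → z < x → rank (z ∷ s) x ≡ suc (rank s x)
rank-∷-< s z<x = cong length (filter-accept (_<? _) z<x)

rank-∷-≮ : ∀ s {z x} → z ≮ x → rank (z ∷ s) x ≡ rank s x
rank-∷-≮ s z≮x = cong length (filter-reject (_<? _) z≮x)

rank-strict : ∀ s {x y} → x ∈ s → x < y → rank s x < rank s y
rank-strict (z ∷ s) {y = y} (here refl) z<y = begin-strict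
  rank (z ∷ s) z ≡⟨ rank-∷-≮ s (<-irrefl refl) ⟩
  rank s z       <⟨ s≤s (rank-mono s (<⇒≤ z<y)) ⟩
  suc (rank s y) ≡⟨ rank-∷-< s z<y ⟨
  rank (z ∷ s) y ∎
  where open ≤-Reasoning
rank-strict (z ∷ s) {x} {y} (there x∈s) x<y with z <? x | z <? y
... | yes z<x | yes z<y rewrite rank-∷-< s z<x | rank-∷-< s z<y = s≤s (rank-strict s x∈s x<y)
... | yes z<x | no  z≮y = contradiction (<-trans z<x x<y) z≮y
... | no  z≮x | yes z<y rewrite rank-∷-≮ s z≮x | rank-∷-< s z<y =
  m≤n⇒m≤1+n (rank-strict s x∈s x<y)
... | no  z≮x | no  z≮y rewrite rank-∷-≮ s z≮x | rank-∷-≮ s z≮y = rank-strict s x∈s x<y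

length-pattern′ : ∀ s → length (pattern′ s) ≡ length s
length-pattern′ s = length-map (rank s) s

nth-pattern′ : ∀ s {a} → a < length s → nth (pattern′ s) a ≡ rank s (nth s a)
nth-pattern′ s = nth-map (rank s) s

pattern′-preserves-< : ∀ {s t} → pattern′ s ≡ pattern′ t → ∀ {a b} →
  a < length s → b < length s → nth s a < nth s b → nth t a < nth t b
pattern′-preserves-< {s} {t} s≈t {a} {b} a< b< sa<sb with nth t a <? nth t b
... | yes ta<tb = ta<tb
... | no  ta≮tb = contradiction (rank-mono t (≮⇒≥ ta≮tb))
  (<⇒≱ (subst₂ _<_ (same-rank a<) (same-rank b<) (rank-strict s (nth-∈ s a<) sa<sb)))
  where
  ∣s∣≡∣t∣ : length s ≡ length t
  ∣s∣≡∣t∣ = trans (sym (length-pattern′ s)) (trans (cong length s≈t) (length-pattern′ t))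
  same-rank : ∀ {c} → c < length s → rank s (nth s c) ≡ rank t (nth t c)
  same-rank {c} c< = begin
    rank s (nth s c)   ≡⟨ nth-pattern′ s c< ⟨
    nth (pattern′ s) c ≡⟨ cong (λ p → nth p c) s≈t ⟩
    nth (pattern′ t) c ≡⟨ nth-pattern′ t (subst (c <_) ∣s∣≡∣t∣ c<) ⟩
    rank t (nth t c)   ∎
    where open ≡-Reasoning

positionsFrom : ∀ {k} → ℕ → Subset k → List ℕ
positionsFrom o []          = []
positionsFrom o (true  ∷ X) = o ∷ positionsFrom (suc o) X
positionsFrom o (false ∷ X) = positionsFrom (suc o) X

positions : ∀ {k} → Subset k → List ℕ
positions = positionsFrom 0

length-positionsFrom : ∀ {k} o (X : Subset k) → length (positionsFrom o X) ≡ ∣ X ∣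
length-positionsFrom o []          = refl
length-positionsFrom o (true  ∷ X) = cong suc (length-positionsFrom (suc o) X)
length-positionsFrom o (false ∷ X) = length-positionsFrom (suc o) X

∈-positionsFrom⁻ : ∀ {k} o (X : Subset k) {z} → z ∈ positionsFrom o X → o ≤ z × z < o + k
∈-positionsFrom⁻ o (true ∷ X) (here refl) = ≤-refl , m<m+n o z<s
∈-positionsFrom⁻ {suc k} o (true ∷ X) {z} (there z∈) with ∈-positionsFrom⁻ (suc o) X z∈
... | o<z , z< = <⇒≤ o<z , subst (z <_) (sym (+-suc o k)) z<
∈-positionsFrom⁻ {suc k} o (false ∷ X) {z} z∈ with ∈-positionsFrom⁻ (suc o) X z∈
... | o<z , z< = <⇒≤ o<z , subst (z <_) (sym (+-suc o k)) z<

∉-positionsFrom-suc : ∀ {k} o (X : Subset k) → o ∉ positionsFrom (suc o) X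
∉-positionsFrom-suc o X o∈ = <-irrefl refl (proj₁ (∈-positionsFrom⁻ (suc o) X o∈))

∈-positionsFrom⁺ : ∀ {k} o (X : Subset k) (i : Fin k) → lookup X i ≡ true →
  o + toℕ i ∈ positionsFrom o X
∈-positionsFrom⁺ o (true  ∷ X) fzero    _  = here (+-identityʳ o)
∈-positionsFrom⁺ o (false ∷ X) fzero    ()
∈-positionsFrom⁺ o (b     ∷ X) (fsuc i) Xi
  with b | subst (_∈ positionsFrom (suc o) X) (sym (+-suc o (toℕ i))) (∈-positionsFrom⁺ (suc o) X i Xi)
... | true  | later = there later
... | false | later = later

positionsFrom-increasing : ∀ {k} o (X : Subset k) {a b} → a < b →
  b < length (positionsFrom o X) → nth (positionsFrom o X) a < nth (positionsFrom o X) b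
positionsFrom-increasing o (true ∷ X) {zero} {suc b} _ (s≤s b<) =
  proj₁ (∈-positionsFrom⁻ (suc o) X (nth-∈ _ b<))
positionsFrom-increasing o (true ∷ X) {suc a} {suc b} (s≤s a<b) (s≤s b<) =
  positionsFrom-increasing (suc o) X a<b b<
positionsFrom-increasing o (false ∷ X) a<b b< = positionsFrom-increasing (suc o) X a<b b<

positionsFrom-injective : ∀ {k} o (X Y : Subset k) → positionsFrom o X ≡ positionsFrom o Y → X ≡ Y
positionsFrom-injective o []          []          _  = refl
positionsFrom-injective o (true ∷ X)  (true ∷ Y)  eq =
  cong (true ∷_) (positionsFrom-injective (suc o) X Y (∷-injectiveʳ eq))
positionsFrom-injective o (false ∷ X) (false ∷ Y) eq =
  cong (false ∷_) (positionsFrom-injective (suc o) X Y eq)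
positionsFrom-injective o (true ∷ X)  (false ∷ Y) eq =
  contradiction (subst (o ∈_) eq (here refl)) (∉-positionsFrom-suc o Y)
positionsFrom-injective o (false ∷ X) (true ∷ Y)  eq =
  contradiction (subst (o ∈_) (sym eq) (here refl)) (∉-positionsFrom-suc o X)

select-tabulate : ∀ {n k} (f : ℕ → ℕ) o (X : Subset k) (g : Fin k → Fin n) →
  (∀ i → toℕ (g i) ≡ f (o + toℕ i)) → select X (tabulate g) ≡ map f (positionsFrom o X)
select-tabulate f o []      g g≗f = refl
select-tabulate f o (b ∷ X) g g≗f
  with b | select-tabulate f (suc o) X (g ∘ fsuc) (λ i → trans (g≗f (fsuc i)) (cong f (+-suc o (toℕ i))))
... | true  | rest = cong₂ _∷_ (trans (g≗f fzero) (cong f (+-identityʳ o))) rest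
... | false | rest = rest

∣X∣>0⇒nonempty : ∀ {j} (X : Subset j) → 0 < ∣ X ∣ → nonempty X ≡ true
∣X∣>0⇒nonempty (true  ∷ X) _     = refl
∣X∣>0⇒nonempty (false ∷ X) ∣X∣>0 = ∣X∣>0⇒nonempty X ∣X∣>0

extensions : ∀ {j} → Subset j → List (Subset (suc j))
extensions X = (true ∷ X) ∷ (false ∷ X) ∷ []

∈-concatMap-extensions⁻ : ∀ {j} {b} {Y : Subset j} xs → (b ∷ Y) ∈ concatMap extensions xs → Y ∈ xs
∈-concatMap-extensions⁻ (X ∷ xs) (here refl)         = here refl
∈-concatMap-extensions⁻ (X ∷ xs) (there (here refl)) = here refl
∈-concatMap-extensions⁻ (X ∷ xs) (there (there Y∈))  = there (∈-concatMap-extensions⁻ xs Y∈)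

∈-concatMap-extensions⁺ : ∀ {j} b {Y : Subset j} xs → Y ∈ xs → (b ∷ Y) ∈ concatMap extensions xs
∈-concatMap-extensions⁺ true  (X ∷ xs) (here refl) = here refl
∈-concatMap-extensions⁺ false (X ∷ xs) (here refl) = there (here refl)
∈-concatMap-extensions⁺ b     (X ∷ xs) (there Y∈)  = there (there (∈-concatMap-extensions⁺ b xs Y∈))

∈-allSubsets : ∀ {j} (X : Subset j) → X ∈ allSubsets j
∈-allSubsets []      = here refl
∈-allSubsets (b ∷ X) = ∈-concatMap-extensions⁺ b _ (∈-allSubsets X)

allSubsets-unique : ∀ j → Unique (allSubsets j)
allSubsets-unique zero    = All.[] ∷ []
allSubsets-unique (suc j) = extensions-unique (allSubsets-unique j)
  where
  extensions-unique : ∀ {xs : List (Subset j)} → Unique xs → Unique (concatMap extensions xs)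
  extensions-unique []                  = []
  extensions-unique {X ∷ xs} (X∉xs ∷ u) =
    ((λ ()) All.∷ fresh true) ∷ fresh false ∷ extensions-unique u
    where
    fresh : ∀ b → All.All ((b ∷ X) ≢_) (concatMap extensions xs)
    fresh b = All.tabulate λ { Y∈ refl → All.lookup X∉xs (∈-concatMap-extensions⁻ xs Y∈) refl }

length-allSubsets : ∀ j → length (allSubsets j) ≡ 2 ^ j
length-allSubsets zero    = refl
length-allSubsets (suc j) = begin
  length (allSubsets (suc j)) ≡⟨ length-concatMap-const (λ _ → refl) (allSubsets j) ⟩
  length (allSubsets j) * 2   ≡⟨ cong (_* 2) (length-allSubsets j) ⟩
  2 ^ j * 2                   ≡⟨ *-comm (2 ^ j) 2 ⟩
  2 ^ suc j                   ∎
  where open ≡-Reasoning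

∈-allVecs : ∀ j {l} (v : Vec (Fin j) l) → v ∈ allVecs j l
∈-allVecs j []      = here refl
∈-allVecs j (x ∷ v) = ∈-concatMap⁺ _ (lose (∈-allFin x) (∈-map⁺ (x ∷_) (∈-allVecs j v)))

patterns≤numPatterns : ∀ {j} (τ : Perm j) {ps : List (List ℕ)} → Unique ps →
  (∀ {p} → p ∈ ps → ∃[ X ] nonempty X ≡ true × p ≡ pattern′ (select X τ)) →
  length ps ≤ numPatterns τ
patterns≤numPatterns τ unique realised = unique-⊆⇒length-≤ unique λ p∈ → occurs (realised p∈)
  where
  occurs : ∀ {p} → ∃[ X ] nonempty X ≡ true × p ≡ pattern′ (select X τ) → p ∈ _
  occurs (X , ne , refl) = ∈-deduplicate⁺ (≡-dec Data.Nat._≟_) (∈-map⁺ (λ X → pattern′ (select X τ))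
    (∈-filter⁺ (λ X → nonempty X Data.Bool.≟ true) (∈-allSubsets X) ne))

-- Counting subsets that meet every mask

disjoint : ∀ {j} → Subset j → Subset j → Bool
disjoint []          []          = true
disjoint (true ∷ M)  (true ∷ X)  = false
disjoint (true ∷ M)  (false ∷ X) = disjoint M X
disjoint (false ∷ M) (_ ∷ X)     = disjoint M X

disjoint≡false⇒meet : ∀ {j} (M X : Subset j) → disjoint M X ≡ false →
  ∃[ i ] lookup M i ≡ true × lookup X i ≡ true
disjoint≡false⇒meet []          []          ()
disjoint≡false⇒meet (true ∷ M)  (true ∷ X)  _ = fzero , refl , refl
disjoint≡false⇒meet (true ∷ M)  (false ∷ X) d with disjoint≡false⇒meet M X d
... | i , Mi , Xi = fsuc i , Mi , Xi
disjoint≡false⇒meet (false ∷ M) (_ ∷ X)     d with disjoint≡false⇒meet M X d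
... | i , Mi , Xi = fsuc i , Mi , Xi

count-disjoint-inside : ∀ {j} (M : Subset j) xs →
  count (disjoint (true ∷ M)) (concatMap extensions xs) ≡ count (disjoint M) xs
count-disjoint-inside M []       = refl
count-disjoint-inside M (X ∷ xs) with disjoint M X
... | true  = cong suc (count-disjoint-inside M xs)
... | false = count-disjoint-inside M xs

count-disjoint-outside : ∀ {j} (M : Subset j) xs →
  count (disjoint (false ∷ M)) (concatMap extensions xs) ≡ count (disjoint M) xs + count (disjoint M) xs
count-disjoint-outside M []       = refl
count-disjoint-outside M (X ∷ xs) with disjoint M X in eq
... | true  rewrite eq = cong suc (trans (cong suc (count-disjoint-outside M xs)) (sym (+-suc _ _)))
... | false rewrite eq = count-disjoint-outside M xs

count-disjoint : ∀ {j} (M : Subset j) → count (disjoint M) (allSubsets j) * 2 ^ ∣ M ∣ ≡ 2 ^ j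
count-disjoint []                  = refl
count-disjoint {suc j} (true ∷ M)  = begin
  count (disjoint (true ∷ M)) (allSubsets (suc j)) * (2 * 2 ^ ∣ M ∣)
    ≡⟨ cong (_* (2 * 2 ^ ∣ M ∣)) (count-disjoint-inside M (allSubsets j)) ⟩
  c * (2 * 2 ^ ∣ M ∣) ≡⟨ *-CS.x∙yz≈y∙xz c 2 (2 ^ ∣ M ∣) ⟩
  2 * (c * 2 ^ ∣ M ∣) ≡⟨ cong (2 *_) (count-disjoint M) ⟩
  2 * 2 ^ j           ∎
  where
  open ≡-Reasoning
  c = count (disjoint M) (allSubsets j)
count-disjoint {suc j} (false ∷ M) = begin
  count (disjoint (false ∷ M)) (allSubsets (suc j)) * 2 ^ ∣ M ∣
    ≡⟨ cong (_* 2 ^ ∣ M ∣) (count-disjoint-outside M (allSubsets j)) ⟩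
  (c + c) * 2 ^ ∣ M ∣           ≡⟨ *-distribʳ-+ (2 ^ ∣ M ∣) c c ⟩
  c * 2 ^ ∣ M ∣ + c * 2 ^ ∣ M ∣ ≡⟨ cong₂ _+_ (count-disjoint M) (count-disjoint M) ⟩
  2 ^ j + 2 ^ j                 ≡⟨ cong (2 ^ j +_) (+-identityʳ (2 ^ j)) ⟨
  2 * 2 ^ j                     ∎
  where
  open ≡-Reasoning
  c = count (disjoint M) (allSubsets j)

meetsAll : ∀ {j} → List (Subset j) → Subset j → Bool
meetsAll ms X = all (λ M → not (disjoint M X)) ms

-- At most length ms · 2^(j − k) subsets of [j] miss some mask; stated multiplied by 2^k.
union-bound : ∀ {j} k (ms : List (Subset j)) → (∀ {M} → M ∈ ms → k ≤ ∣ M ∣) →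
  2 ^ j * 2 ^ k ≤ count (meetsAll ms) (allSubsets j) * 2 ^ k + length ms * 2 ^ j
union-bound {j} k [] _ = ≤-reflexive (trans (cong (_* 2 ^ k) all-meet) (sym (+-identityʳ _)))
  where
  open ≡-Reasoning
  all-meet : 2 ^ j ≡ count (meetsAll []) (allSubsets j)
  all-meet = begin
    2 ^ j                              ≡⟨ length-allSubsets j ⟨
    length (allSubsets j)              ≡⟨ cong length (filter-all (T? ∘ meetsAll []) everything) ⟨
    count (meetsAll []) (allSubsets j) ∎
    where everything = All.universal _ (allSubsets j)
union-bound {j} k (M ∷ ms) k≤∣ms∣ = begin
  2 ^ j * 2 ^ k                              ≤⟨ union-bound k ms (k≤∣ms∣ ∘ there) ⟩
  count (meetsAll ms) S * 2 ^ k + l * 2 ^ j  ≤⟨ +-monoˡ-≤ (l * 2 ^ j) (*-monoˡ-≤ (2 ^ k) split-on-M) ⟩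
  (c + d) * 2 ^ k + l * 2 ^ j                ≡⟨ cong (_+ l * 2 ^ j) (*-distribʳ-+ (2 ^ k) c d) ⟩
  (c * 2 ^ k + d * 2 ^ k) + l * 2 ^ j        ≡⟨ +-assoc (c * 2 ^ k) _ _ ⟩
  c * 2 ^ k + (d * 2 ^ k + l * 2 ^ j)        ≤⟨ +-monoʳ-≤ (c * 2 ^ k) (+-monoˡ-≤ (l * 2 ^ j) d*2^k≤2^j) ⟩
  c * 2 ^ k + length (M ∷ ms) * 2 ^ j        ∎
  where
  open ≤-Reasoning
  S = allSubsets j
  l = length ms
  c = count (meetsAll (M ∷ ms)) S
  d = count (disjoint M) S
  split-on-M : count (meetsAll ms) S ≤ c + d
  split-on-M = count-≤-∧-not (meetsAll ms) (disjoint M) S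
  d*2^k≤2^j : d * 2 ^ k ≤ 2 ^ j
  d*2^k≤2^j = begin
    d * 2 ^ k     ≤⟨ *-monoʳ-≤ d (^-monoʳ-≤ 2 (k≤∣ms∣ (here refl))) ⟩
    d * 2 ^ ∣ M ∣ ≡⟨ count-disjoint M ⟩
    2 ^ j         ∎

-- Staircases in a grid

data Staircase (L : ℕ) (P Q : ℕ → ℕ → Set) : ℕ → ℕ → Set where
  start   : ∀ {a} → a < L → Staircase L P Q a 0
  ascend  : ∀ {a b d} → Staircase L P Q a d → b < L → P a b → Q a b → Staircase L P Q b d
  descend : ∀ {a b d} → Staircase L P Q a d → b < L → P a b → Q b a → Staircase L P Q b (suc d)

staircase-end< : ∀ {L P Q a d} → Staircase L P Q a d → a < L
staircase-end< (start a<)         = a<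
staircase-end< (ascend _ b< _ _)  = b<
staircase-end< (descend _ b< _ _) = b<

staircase-mono : ∀ {L P Q L′ P′ Q′} → (∀ {a} → a < L → a < L′) →
  (∀ {a b} → a < L → b < L → P a b → P′ a b) →
  (∀ {a b} → a < L → b < L → Q a b → Q′ a b) →
  ∀ {a d} → Staircase L P Q a d → Staircase L′ P′ Q′ a d
staircase-mono L⇒ P⇒ Q⇒ (start a<)         = start (L⇒ a<)
staircase-mono L⇒ P⇒ Q⇒ (ascend s b< p q)  = let a< = staircase-end< s in
  ascend (staircase-mono L⇒ P⇒ Q⇒ s) (L⇒ b<) (P⇒ a< b< p) (Q⇒ a< b< q)
staircase-mono L⇒ P⇒ Q⇒ (descend s b< p q) = let a< = staircase-end< s in
  descend (staircase-mono L⇒ P⇒ Q⇒ s) (L⇒ b<) (P⇒ a< b< p) (Q⇒ b< a< q)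

data Half : Set where
  lower upper : Half

InHalf : ℕ → Half → ℕ → Set
InHalf k lower j = j < k
InHalf k upper j = k ≤ j

inHalf? : ∀ k h j → Dec (InHalf k h j)
inHalf? k lower j = j <? k
inHalf? k upper j = k ≤? j

halfStart : ℕ → Half → ℕ
halfStart k lower = 0
halfStart k upper = k

inHalf-halfStart : ∀ k h {v} → v < k → InHalf k h (halfStart k h + v)
inHalf-halfStart k lower     v<k = v<k
inHalf-halfStart k upper {v} _   = m≤m+n k v

halfStart+<2k : ∀ k h {v} → v < k → halfStart k h + v < 2 * k
halfStart+<2k k lower {v} v<k = <-≤-trans v<k (m≤m+n k (k + 0))
halfStart+<2k k upper {v} v<k = +-monoʳ-< k (subst (v <_) (sym (+-identityʳ k)) v<k)

module Grid (m : ℕ) .{{_ : NonZero m}} where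

  cell : ℕ → ℕ → ℕ
  cell i j = i * m + j

  row col : ℕ → ℕ
  row p = p / m
  col p = p % m

  cell-row-col : ∀ p → cell (row p) (col p) ≡ p
  cell-row-col p = trans (+-comm (row p * m) (col p)) (sym (m≡m%n+[m/n]*n p m))

  row-cell : ∀ i {j} → j < m → row (cell i j) ≡ i
  row-cell i {j} j<m = begin
    (i * m + j) / m   ≡⟨ +-distrib-/-∣ˡ j (divides-refl i) ⟩
    i * m / m + j / m ≡⟨ cong₂ _+_ (m*n/n≡m i m) (m<n⇒m/n≡0 j<m) ⟩
    i + 0             ≡⟨ +-identityʳ i ⟩
    i                 ∎
    where open ≡-Reasoning

  col-cell : ∀ i {j} → j < m → col (cell i j) ≡ j
  col-cell i {j} j<m =
    trans (cong (_% m) (+-comm (i * m) j)) (trans ([m+kn]%n≡m%n j i m) (m<n⇒m%n≡m j<m))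

  col<m : ∀ p → col p < m
  col<m p = m%n<n p m

  row<m : ∀ {p} → p < m * m → row p < m
  row<m = m<n*o⇒m/o<n

  cell-mono-row : ∀ {i i′ j j′} → i < i′ → j < m → cell i j < cell i′ j′
  cell-mono-row {i} {i′} {j} {j′} i<i′ j<m = begin-strict
    i * m + j   <⟨ +-monoʳ-< (i * m) j<m ⟩
    i * m + m   ≡⟨ +-comm (i * m) m ⟩
    suc i * m   ≤⟨ *-monoˡ-≤ m i<i′ ⟩
    i′ * m      ≤⟨ m≤m+n (i′ * m) j′ ⟩
    i′ * m + j′ ∎
    where open ≤-Reasoning

  cell-mono-col : ∀ i {j j′} → j < j′ → cell i j < cell i j′
  cell-mono-col i = +-monoʳ-< (i * m)

  cell<m*m : ∀ {i j} → i < m → j < m → cell i j < m * m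
  cell<m*m {i} {j} i<m j<m =
    subst (cell i j <_) (+-identityʳ (m * m)) (cell-mono-row {j′ = 0} i<m j<m)

  cell-<⇒row-≤ : ∀ {i i′ j j′} → j′ < m → cell i j < cell i′ j′ → i ≤ i′
  cell-<⇒row-≤ {i} {i′} j′<m c< with i ≤? i′
  ... | yes i≤i′ = i≤i′
  ... | no  i≰i′ = contradiction (cell-mono-row (≰⇒> i≰i′) j′<m) (<-asym c<)

  cell-<⇒col-< : ∀ i {j j′} → cell i j < cell i j′ → j < j′
  cell-<⇒col-< i = +-cancelˡ-< (i * m) _ _

  transpose : ℕ → ℕ
  transpose p = cell (col p) (row p)

  transpose-involutive : ∀ {p} → p < m * m → transpose (transpose p) ≡ p
  transpose-involutive {p} p< = begin
    cell (col (cell (col p) (row p))) (row (cell (col p) (row p)))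
      ≡⟨ cong₂ cell (col-cell (col p) (row<m p<)) (row-cell (col p) (row<m p<)) ⟩
    cell (row p) (col p) ≡⟨ cell-row-col p ⟩
    p                    ∎
    where open ≡-Reasoning

  Lex : (I J : ℕ → ℕ) → ℕ → ℕ → Set
  Lex I J a b = cell (I a) (J a) < cell (I b) (J b)

  Split : ℕ → ℕ → (I J : ℕ → ℕ) → Set
  Split k L I J = ∀ h r → r < m → ∃[ a ] a < L × I a ≡ r × InHalf k h (J a)

  module Heights {L : ℕ} (I J : ℕ → ℕ)
    (I<m : ∀ {a} → a < L → I a < m) (J<m : ∀ {a} → a < L → J a < m) where

    staircase-height≤ : ∀ {P Q : ℕ → ℕ → Set} →
      (∀ {a b} → a < L → b < L → P a b → Lex I J a b) →
      (∀ {a b} → a < L → b < L → Q a b → Lex J I a b) →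
      ∀ {a d} → Staircase L P Q a d → d ≤ I a
    staircase-height≤ P⇒ Q⇒ (start _) = z≤n
    staircase-height≤ P⇒ Q⇒ (ascend s b< p _) =
      ≤-trans (staircase-height≤ P⇒ Q⇒ s) (cell-<⇒row-≤ (J<m b<) (P⇒ (staircase-end< s) b< p))
    staircase-height≤ P⇒ Q⇒ {b} (descend {a} s b< p q) =
      <-≤-trans (s≤s (staircase-height≤ P⇒ Q⇒ s)) Ia<Ib
      where
      a< = staircase-end< s
      -- Within one row P and Q agree, so a descent changes row.
      Ia<Ib : I a < I b
      Ia<Ib with m≤n⇒m<n∨m≡n (cell-<⇒row-≤ (J<m b<) (P⇒ a< b< p))
      ... | inj₁ Ia<Ib = Ia<Ib
      ... | inj₂ Ia≡Ib = contradiction (cell-mono-row Ja<Jb (I<m a<)) (<-asym (Q⇒ b< a< q))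
        where
        Ja<Jb : J a < J b
        Ja<Jb = cell-<⇒col-< (I b) (subst (λ i → cell i (J a) < cell (I b) (J b)) Ia≡Ib (P⇒ a< b< p))

    module _ {P Q : ℕ → ℕ → Set}
      (⇒P : ∀ {a b} → a < L → b < L → Lex I J a b → P a b)
      (⇒Q : ∀ {a b} → a < L → b < L → Lex J I a b → Q a b)
      {k : ℕ} (split : Split k L I J) where

      -- A lower-half element of row r + 1 is reached by descending from an upper-half element
      -- of row r; any other element of row r + 1 by ascending from a lower-half one.
      staircase-to-row       : ∀ r {a} → a < L → I a ≡ r → Staircase L P Q a r
      staircase-to-lower-row : ∀ r {a} → a < L → I a ≡ suc r → J a < k → Staircase L P Q a (suc r)

      staircase-to-row zero    a< _ = start a<
      staircase-to-row (suc r) {a} a< Ia≡ with J a <? k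
      ... | yes Ja<k = staircase-to-lower-row r a< Ia≡ Ja<k
      ... | no  Ja≮k with split lower (suc r) (subst (_< m) Ia≡ (I<m a<))
      ... | l , l< , Il≡ , Jl<k = ascend (staircase-to-lower-row r l< Il≡ Jl<k) a<
              (⇒P l< a< (subst (λ i → cell i (J l) < cell (I a) (J a)) (trans Ia≡ (sym Il≡))
                                 (cell-mono-col (I a) Jl<Ja)))
              (⇒Q l< a< (cell-mono-row Jl<Ja (I<m l<)))
        where Jl<Ja = <-≤-trans Jl<k (≮⇒≥ Ja≮k)

      staircase-to-lower-row r {a} a< Ia≡ Ja<k
        with split upper r (<-trans (n<1+n r) (subst (_< m) Ia≡ (I<m a<)))
      ... | u , u< , Iu≡ , k≤Ju = descend (staircase-to-row r u< Iu≡) a<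
              (⇒P u< a< (cell-mono-row (subst₂ _<_ (sym Iu≡) (sym Ia≡) (n<1+n r)) (J<m u<)))
              (⇒Q a< u< (cell-mono-row (<-≤-trans Ja<k k≤Ju) (I<m a<)))

-- The transposition of the m × m grid

module TransposeGrid (k : ℕ) .{{_ : NonZero k}} where

  m : ℕ
  m = 2 * k

  instance
    m≢0 : NonZero m
    m≢0 = m*n≢0 2 k

  n : ℕ
  n = m * m

  open Grid m public

  transpose<n : ∀ {p} → p < n → transpose p < n
  transpose<n p< = cell<m*m (col<m _) (row<m p<)

  σ : Perm n
  σ = tabulate λ i → fromℕ< (transpose<n (toℕ<n i))

  select-σ : ∀ X → select X σ ≡ map transpose (positions X)
  select-σ X = select-tabulate transpose 0 X _ λ i → toℕ-fromℕ< (transpose<n (toℕ<n i))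

  patternOf : Subset n → List ℕ
  patternOf X = pattern′ (select X σ)

  module Points (X : Subset n) where

    L : ℕ
    L = length (positions X)

    R C : ℕ → ℕ
    R a = row (nth (positions X) a)
    C a = col (nth (positions X) a)

    Value< : ℕ → ℕ → Set
    Value< a b = nth (select X σ) a < nth (select X σ) b

    R<m : ∀ {a} → a < L → R a < m
    R<m a< = row<m (proj₂ (∈-positionsFrom⁻ 0 X (nth-∈ _ a<)))

    C<m : ∀ {a} → a < L → C a < m
    C<m _ = col<m _

    at-cell : ∀ a → nth (positions X) a ≡ cell (R a) (C a)
    at-cell a = sym (cell-row-col _)

    value-at : ∀ {a} → a < L → nth (select X σ) a ≡ cell (C a) (R a)
    value-at {a} a< = trans (cong (λ s → nth s a) (select-σ X)) (nth-map transpose (positions X) a<)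

    <⇒Lex : ∀ {a b} → a < L → b < L → a < b → Lex R C a b
    <⇒Lex {a} {b} _ b< a<b = subst₂ _<_ (at-cell a) (at-cell b) (positionsFrom-increasing 0 X a<b b<)

    Lex⇒< : ∀ {a b} → a < L → b < L → Lex R C a b → a < b
    Lex⇒< {a} {b} a< b< lex with <-cmp a b
    ... | tri< a<b _ _  = a<b
    ... | tri≈ _ refl _ = contradiction lex (<-irrefl refl)
    ... | tri> _ _ b<a  = contradiction lex (<-asym (<⇒Lex b< a< b<a))

    Value<⇒Lex : ∀ {a b} → a < L → b < L → Value< a b → Lex C R a b
    Value<⇒Lex a< b< = subst₂ _<_ (value-at a<) (value-at b<)

    Lex⇒Value< : ∀ {a b} → a < L → b < L → Lex C R a b → Value< a b
    Lex⇒Value< a< b< = subst₂ _<_ (sym (value-at a<)) (sym (value-at b<))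

    length-select : length (select X σ) ≡ L
    length-select = trans (cong length (select-σ X)) (length-map transpose (positions X))

    length-patternOf : length (patternOf X) ≡ L
    length-patternOf = trans (length-pattern′ (select X σ)) length-select

  Good : Subset n → Set
  Good X = Split k L R C × Split k L C R
    where open Points X

  module Compare (X Y : Subset n) (same : patternOf X ≡ patternOf Y) where
    private
      module X  = Points X
      module Y  = Points Y
      module HX = Heights X.R X.C X.R<m X.C<m
      module HY = Heights Y.R Y.C Y.R<m Y.C<m
      module VX = Heights X.C X.R X.C<m X.R<m
      module VY = Heights Y.C Y.R Y.C<m Y.R<m

    L≡L : X.L ≡ Y.L
    L≡L = trans (sym X.length-patternOf) (trans (cong length same) Y.length-patternOf)

    <L⇒<L : ∀ {a} → a < X.L → a < Y.L
    <L⇒<L {a} = subst (a <_) L≡L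

    Value<⇒Value< : ∀ {a b} → a < X.L → b < X.L → X.Value< a b → Y.Value< a b
    Value<⇒Value< {a} {b} a< b< =
      pattern′-preserves-< same (subst (a <_) (sym X.length-select) a<) (subst (b <_) (sym X.length-select) b<)

    R≤R : Split k X.L X.R X.C → ∀ {a} → a < X.L → X.R a ≤ Y.R a
    R≤R split a< = HY.staircase-height≤ Y.<⇒Lex Y.Value<⇒Lex
      (staircase-mono <L⇒<L (λ _ _ a<b → a<b) Value<⇒Value<
        (HX.staircase-to-row X.Lex⇒< X.Lex⇒Value< split _ a< refl))

    C≤C : Split k X.L X.C X.R → ∀ {a} → a < X.L → X.C a ≤ Y.C a
    C≤C split a< = VY.staircase-height≤ Y.Value<⇒Lex Y.<⇒Lex
      (staircase-mono <L⇒<L Value<⇒Value< (λ _ _ a<b → a<b)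
        (VX.staircase-to-row X.Lex⇒Value< X.Lex⇒< split _ a< refl))

  patternOf-injective : ∀ {X Y} → Good X → Good Y → patternOf X ≡ patternOf Y → X ≡ Y
  patternOf-injective {X} {Y} (rowsX , colsX) (rowsY , colsY) same =
    positionsFrom-injective 0 X Y (nth-ext (positions X) (positions Y) XY.L≡L same-cell)
    where
    module XY = Compare X Y same
    module YX = Compare Y X (sym same)
    module X  = Points X
    module Y  = Points Y
    same-cell : ∀ a → a < X.L → nth (positions X) a ≡ nth (positions Y) a
    same-cell a a< = begin
      nth (positions X) a  ≡⟨ X.at-cell a ⟩
      cell (X.R a) (X.C a) ≡⟨ cong₂ cell (≤-antisym (XY.R≤R rowsX a<) (YX.R≤R rowsY a<′))
                                         (≤-antisym (XY.C≤C colsX a<) (YX.C≤C colsY a<′)) ⟩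
      cell (Y.R a) (Y.C a) ≡⟨ Y.at-cell a ⟨
      nth (positions Y) a  ∎
      where
      open ≡-Reasoning
      a<′ = XY.<L⇒<L a<

module Masks (k : ℕ) .{{_ : NonZero k}} where

  open TransposeGrid k

  mask : (I J : ℕ → ℕ) → Half → ℕ → Subset n
  mask I J h r = tabulate λ i → does (I (toℕ i) ≟ r ×-dec inHalf? k h (J (toℕ i)))

  meets-mask : ∀ I J {h r} X → disjoint (mask I J h r) X ≡ false →
    ∃[ a ] a < length (positions X) × I (nth (positions X) a) ≡ r × InHalf k h (J (nth (positions X) a))
  meets-mask I J {h} {r} X d with disjoint≡false⇒meet (mask I J h r) X d
  ... | i , in-mask , in-X with ∈⇒nth (positions X) (∈-positionsFrom⁺ 0 X i in-X)
  ... | a , a< , at-a = a , a< , subst (λ c → I c ≡ r × InHalf k h (J c)) (sym at-a)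
    (does≡true⇒ (I (toℕ i) ≟ r ×-dec inHalf? k h (J (toℕ i)))
      (trans (sym (lookup∘tabulate _ i)) in-mask))

  size-mask : ∀ (I J : ℕ → ℕ) h r (place : ℕ → ℕ) →
    (∀ {j} → j < m → place j < n × I (place j) ≡ r × J (place j) ≡ j) → k ≤ ∣ mask I J h r ∣
  size-mask I J h r place placed = begin
    k                                 ≡⟨ length-upTo k ⟨
    length (upTo k)                   ≡⟨ length-map cellAt (upTo k) ⟨
    length (map cellAt (upTo k))      ≤⟨ unique-⊆⇒length-≤ cells-unique cells⊆mask ⟩
    length (positions (mask I J h r)) ≡⟨ length-positionsFrom 0 (mask I J h r) ⟩
    ∣ mask I J h r ∣                  ∎
    where
    open ≤-Reasoning
    cellAt : ℕ → ℕ
    cellAt v = place (halfStart k h + v)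
    placed-at : ∀ {v} → v < k →
      cellAt v < n × I (cellAt v) ≡ r × J (cellAt v) ≡ halfStart k h + v
    placed-at v<k = placed (halfStart+<2k k h v<k)
    cells-unique : Unique (map cellAt (upTo k))
    cells-unique = unique-map⁺ (λ v∈ w∈ eq → +-cancelˡ-≡ (halfStart k h) _ _ (begin-equality
      halfStart k h + _ ≡⟨ proj₂ (proj₂ (placed-at (∈-upTo⁻ v∈))) ⟨
      J (cellAt _)      ≡⟨ cong J eq ⟩
      J (cellAt _)      ≡⟨ proj₂ (proj₂ (placed-at (∈-upTo⁻ w∈))) ⟩
      halfStart k h + _ ∎)) (Unique.upTo⁺ k)
    cells⊆mask : ∀ {c} → c ∈ map cellAt (upTo k) → c ∈ positions (mask I J h r)
    cells⊆mask c∈ with ∈-map⁻ cellAt c∈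
    ... | v , v∈ , refl with placed-at (∈-upTo⁻ v∈)
    ... | c<n , Ic≡r , Jc≡ = subst (_∈ positions (mask I J h r)) (toℕ-fromℕ< c<n)
            (∈-positionsFrom⁺ 0 (mask I J h r) i (trans (lookup∘tabulate _ i)
              (dec-true (_ ≟ r ×-dec inHalf? k h _)
                (subst (λ c → I c ≡ r × InHalf k h (J c)) (sym (toℕ-fromℕ< c<n))
                  (Ic≡r , subst (InHalf k h) (sym Jc≡) (inHalf-halfStart k h (∈-upTo⁻ v∈)))))))
      where i = fromℕ< c<n

  masksAt : ℕ → List (Subset n)
  masksAt r = mask row col lower r ∷ mask row col upper r
            ∷ mask col row lower r ∷ mask col row upper r ∷ []

  masks : List (Subset n)
  masks = concatMap masksAt (upTo m)

  length-masks : length masks ≡ 4 * m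
  length-masks = begin
    length masks       ≡⟨ length-concatMap-const (λ _ → refl) (upTo m) ⟩
    length (upTo m) * 4 ≡⟨ cong (_* 4) (length-upTo m) ⟩
    m * 4              ≡⟨ *-comm m 4 ⟩
    4 * m              ∎
    where open ≡-Reasoning

  size-masks : ∀ {M} → M ∈ masks → k ≤ ∣ M ∣
  size-masks M∈ with find (∈-concatMap⁻ masksAt {xs = upTo m} M∈)
  ... | r , r∈ , M∈masksAt = size-masksAt M∈masksAt
    where
    r<m = ∈-upTo⁻ r∈
    along-row : ∀ {j} → j < m → cell r j < n × row (cell r j) ≡ r × col (cell r j) ≡ j
    along-row j<m = cell<m*m r<m j<m , row-cell r j<m , col-cell r j<m
    along-col : ∀ {j} → j < m → cell j r < n × col (cell j r) ≡ r × row (cell j r) ≡ j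
    along-col {j} j<m = cell<m*m j<m r<m , col-cell j r<m , row-cell j r<m
    size-masksAt : ∀ {M} → M ∈ masksAt r → k ≤ ∣ M ∣
    size-masksAt (here refl)                         = size-mask row col lower r (cell r) along-row
    size-masksAt (there (here refl))                 = size-mask row col upper r (cell r) along-row
    size-masksAt (there (there (here refl)))         = size-mask col row lower r (λ j → cell j r) along-col
    size-masksAt (there (there (there (here refl)))) = size-mask col row upper r (λ j → cell j r) along-col

  meetsAll⇒Good : ∀ X → T (meetsAll masks X) → Good X
  meetsAll⇒Good X meets = (λ h r r< → meets-mask row col X (misses (rows∈ h r<)))
                        , (λ h r r< → meets-mask col row X (misses (cols∈ h r<)))
    where
    misses : ∀ {M} → M ∈ masks → disjoint M X ≡ false
    misses M∈ = Equivalence.to T-not-≡ (T-all⇒∈ (λ M → not (disjoint M X)) masks meets M∈)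
    in-masks : ∀ {M r} → r < m → M ∈ masksAt r → M ∈ masks
    in-masks r<m M∈ = ∈-concatMap⁺ masksAt (lose (∈-upTo⁺ r<m) M∈)
    rows∈ : ∀ h {r} → r < m → mask row col h r ∈ masks
    rows∈ lower r<m = in-masks r<m (here refl)
    rows∈ upper r<m = in-masks r<m (there (here refl))
    cols∈ : ∀ h {r} → r < m → mask col row h r ∈ masks
    cols∈ lower r<m = in-masks r<m (there (there (here refl)))
    cols∈ upper r<m = in-masks r<m (there (there (there (here refl))))

module LowerBound (k : ℕ) .{{_ : NonZero k}} where

  open TransposeGrid k
  open Masks k

  instance
    n≢0 : NonZero n
    n≢0 = m*n≢0 m m

  σ∈allPerms : σ ∈ allPerms n
  σ∈allPerms = ∈-filter⁺ _ (∈-allVecs n σ) (toList-unique (VecUnique.tabulate⁺ λ {i} {j} eq →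
    toℕ-injective (begin
      toℕ i                         ≡⟨ transpose-involutive (toℕ<n i) ⟨
      transpose (transpose (toℕ i)) ≡⟨ cong transpose (trans (sym (toℕ-fromℕ< _))
                                                        (trans (cong toℕ eq) (toℕ-fromℕ< _))) ⟩
      transpose (transpose (toℕ j)) ≡⟨ transpose-involutive (toℕ<n j) ⟩
      toℕ j                         ∎)))
    where open ≡-Reasoning

  Good⇒2≤∣X∣ : ∀ X → Good X → 2 ≤ ∣ X ∣
  Good⇒2≤∣X∣ X (rows , _) with rows lower 0 (>-nonZero⁻¹ m) | rows upper 0 (>-nonZero⁻¹ m)
  ... | a , a< , _ , Ca<k | b , b< , _ , k≤Cb =
    subst (2 ≤_) (length-positionsFrom 0 X)
      (distinct-indices⇒2≤ a< b< λ { refl → <-irrefl refl (<-≤-trans Ca<k k≤Cb) })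

  goodSubsets : List (Subset n)
  goodSubsets = filterᵇ (meetsAll masks) (allSubsets n)

  ∈-goodSubsets⇒Good : ∀ {X} → X ∈ goodSubsets → Good X
  ∈-goodSubsets⇒Good {X} X∈ =
    meetsAll⇒Good X (proj₂ (∈-filter⁻ (T? ∘ meetsAll masks) {xs = allSubsets n} X∈))

  i₀ : Fin n
  i₀ = fromℕ< (>-nonZero⁻¹ n)

  singleton : Subset n
  singleton = ⁅ i₀ ⁆

  ∣singleton∣≡1 : ∣ singleton ∣ ≡ 1
  ∣singleton∣≡1 = ∣⁅x⁆∣≡1 i₀

  length-patternOf-size : ∀ X → length (patternOf X) ≡ ∣ X ∣
  length-patternOf-size X = trans (Points.length-patternOf X) (length-positionsFrom 0 X)

  count-meetsAll<numPatterns : count (meetsAll masks) (allSubsets n) < numPatterns σ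
  count-meetsAll<numPatterns = subst (_≤ numPatterns σ) (cong suc (length-map patternOf goodSubsets))
    (patterns≤numPatterns σ (singleton-new ∷ unique-map⁺ injective good-unique) realised)
    where
    injective : ∀ {X Y} → X ∈ goodSubsets → Y ∈ goodSubsets → patternOf X ≡ patternOf Y → X ≡ Y
    injective {X} {Y} X∈ Y∈ =
      patternOf-injective {X} {Y} (∈-goodSubsets⇒Good X∈) (∈-goodSubsets⇒Good Y∈)
    good-unique : Unique goodSubsets
    good-unique = Unique.filter⁺ _ (allSubsets-unique n)
    singleton-new : All.All (patternOf singleton ≢_) (map patternOf goodSubsets)
    singleton-new = All.map⁺ (All.tabulate λ {X} X∈ same → <-irrefl
      (trans (sym ∣singleton∣≡1) (trans (sym (length-patternOf-size singleton))
        (trans (cong length same) (length-patternOf-size X))))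
      (Good⇒2≤∣X∣ X (∈-goodSubsets⇒Good X∈)))
    realised : ∀ {p} → p ∈ patternOf singleton ∷ map patternOf goodSubsets →
      ∃[ X ] nonempty X ≡ true × p ≡ patternOf X
    realised (here refl) =
      singleton , ∣X∣>0⇒nonempty singleton (≤-reflexive (sym ∣singleton∣≡1)) , refl
    realised (there p∈) with ∈-map⁻ patternOf p∈
    ... | X , X∈ , refl =
      X , ∣X∣>0⇒nonempty X (<-≤-trans z<s (Good⇒2≤∣X∣ X (∈-goodSubsets⇒Good X∈))) , refl

  count-meetsAll<h : count (meetsAll masks) (allSubsets n) < h n
  count-meetsAll<h = ≤-trans count-meetsAll<numPatterns (≤-foldr-⊔ numPatterns (allPerms n) σ∈allPerms)

mainTheorem2 : (n k : ℕ) → 1 ≤ k → n ≡ (2 * k) * (2 * k) →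
    2 ^ n * 2 ^ k < h n * 2 ^ k + 2 ^ n * (4 * (2 * k))
mainTheorem2 _ k 1≤k refl = begin-strict
  2 ^ n * 2 ^ k                   ≤⟨ union-bound k masks size-masks ⟩
  c * 2 ^ k + l * 2 ^ n           <⟨ +-monoˡ-< (l * 2 ^ n) (m<n+m (c * 2 ^ k) (m^n>0 2 k)) ⟩
  suc c * 2 ^ k + l * 2 ^ n       ≤⟨ +-monoˡ-≤ (l * 2 ^ n) (*-monoˡ-≤ (2 ^ k) count-meetsAll<h) ⟩
  h n * 2 ^ k + l * 2 ^ n         ≡⟨ cong (λ l → h n * 2 ^ k + l * 2 ^ n) length-masks ⟩
  h n * 2 ^ k + 4 * m * 2 ^ n     ≡⟨ cong (h n * 2 ^ k +_) (*-comm (4 * m) (2 ^ n)) ⟩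
  h n * 2 ^ k + 2 ^ n * (4 * m)   ∎
  where
  instance
    k≢0 : NonZero k
    k≢0 = >-nonZero 1≤k
  open TransposeGrid k
  open Masks k
  open LowerBound k
  open ≤-Reasoning
  c = count (meetsAll masks) (allSubsets n)
  l = length masks
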